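{- Let $\mathcal{D}$ be a Ryser design of order $v$ and index $\lambda$, with replication numbers $r_1>r_2$, let $e_1$ be the number of points with replication number $r_1$, and let $D=e_1-r_2$. (a) If $D\le -1$, then $v\ge 4\lambda-1$. (b) If $D\ge 0$, then $\lambda^2+\lambda+1\ge v$.
   Context: A Ryser design of order $v$ and index $\lambda$ is a pair $(X,L)$ where $X$ is a set of $v$ points and $L$ is a collection of $v$ subsets (blocks) of $X$ such that any two distinct blocks meet in exactly $\lambda$ points, every block has size $>\lambda$, and there exist two blocks of different sizes. It is known that there are integers $r_1>r_2$ with $r_1+r_2=v+1$ such that every point lies in exactly $r_1$ or exactly $r_2$ blocks (the replication numbers). -}

module Defs where

open import Data.Nat using (ℕ; _<_; _≟_; _+_; suc)
open import Data.Sum using (_⊎_)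
open import Data.Fin using (Fin)
open import Data.Fin.Subset using (Subset; _∩_; ∣_∣)
open import Data.Vec using (lookup; tabulate)
open import Data.Product using (∃₂; _×_)
open import Relation.Binary.PropositionalEquality using (_≡_; _≢_)
open import Relation.Nullary.Decidable using (⌊_⌋)

-- Points are Fin v; the v blocks are indexed by Fin v, each a subset of the points.
Blocks : ℕ → Set
Blocks v = Fin v → Subset v

record IsRyserDesign (v lam : ℕ) (B : Blocks v) : Set where
  field
    intersect : ∀ (i j : Fin v) → i ≢ j → ∣ B i ∩ B j ∣ ≡ lam
    bigBlocks : ∀ (i : Fin v) → lam < ∣ B i ∣
    twoSizes  : ∃₂ λ (i j : Fin v) → ∣ B i ∣ ≢ ∣ B j ∣

replication : ∀ {v} → Blocks v → Fin v → ℕ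
replication B x = ∣ tabulate (λ i → lookup (B i) x) ∣

pointsWithReplication : ∀ {v} → Blocks v → ℕ → ℕ
pointsWithReplication B r = ∣ tabulate (λ x → ⌊ replication B x ≟ r ⌋) ∣

record AreReplicationNumbers (v : ℕ) (B : Blocks v) (r₁ r₂ : ℕ) : Set where
  field
    r₂<r₁   : r₂ < r₁
    sumRule : r₁ + r₂ ≡ suc v
    cover   : ∀ (x : Fin v) → replication B x ≡ r₁ ⊎ replication B x ≡ r₂

module Submission where

-- Write ρ(x) for the replication number of the point x.  Double counting flags and
-- pairs of flags gives  Σ ρ(x) = Σ |Bᵢ|  and  Σ ρ(x)² = Σᵢ Σⱼ |Bᵢ ∩ Bⱼ|; since
-- distinct blocks meet in λ points this yields the moment identity
-- Σ ρ² + vλ = Σ ρ + v²λ, and since every block has more than λ points,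
-- Σ ρ ≥ v(λ + 1).  Splitting the sums by replication class and writing
-- r₁ = 1 + r₂ + c, v = 2r₂ + c (from r₁ + r₂ = v + 1), the identity becomes, after
-- cancelling v, the key equation  e(1 + c) + r₂² + λ = λv + r₂, and the inequality
-- becomes  v + λ ≤ r₁r₂.  The rest is arithmetic in ℕ:
--   (a) e < r₂ bounds λ(v − 1) by (r₂ − 1)(r₂ + c + 1) ≤ v²/4, whence 4λ ≤ v + 1;
--   (b) e ≥ r₂ forces r₂ ≥ 2 and then e > λ, so 1 + c ≤ (e − λ)(1 + c), which
--       together with (λ − r₂ + 1)(λ − r₂ + 2) ≥ 0 gives v ≤ λ² + λ + 1.
-- The file develops finite sums, the counting identities for an arbitrary family
-- of blocks, the arithmetic, and finally translates the result to the integer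
-- formulation D = e − r₂ of the theorem.

open import Defs
open import Data.Nat using (ℕ)

module FiniteSums where
  open import Data.Nat using (zero; suc; _+_; _*_; _≤_; z≤n)
  open import Data.Nat.Properties
    using (+-*-semiring; +-mono-≤; +-assoc; +-comm; +-identityʳ; *-identityʳ)
  open import Data.Bool using (Bool; true; false; not; _∧_; if_then_else_)
  open import Data.Fin using (Fin; zero; suc; punchIn)
  open import Data.Fin.Properties using (punchInᵢ≢i)
  open import Data.Fin.Subset using (Subset; ∣_∣)
  open import Data.Vec using ([]; _∷_; lookup)
  open import Function using (_∘_)
  open import Relation.Binary.PropositionalEquality
  open import Algebra.Properties.Semiring.Sum +-*-semiring public
    using (sum; ∑-distrib-+; ∑-comm; sum-cong-≗; *-distribˡ-sum; *-distribʳ-sum)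
  open import Algebra.Properties.Semiring.Sum +-*-semiring using (sum-remove)
  open ≡-Reasoning

  sum-const : ∀ n c → sum {n} (λ _ → c) ≡ n * c
  sum-const zero    c = refl
  sum-const (suc n) c = cong (c +_) (sum-const n c)

  sum-mono : ∀ {n} {f g : Fin n → ℕ} → (∀ i → f i ≤ g i) → sum f ≤ sum g
  sum-mono {zero}  f≤g = z≤n
  sum-mono {suc n} f≤g = +-mono-≤ (f≤g zero) (sum-mono (f≤g ∘ suc))

  sum-except : ∀ {n} (g : Fin n → ℕ) (i : Fin n) c → (∀ j → j ≢ i → g j ≡ c) →
    sum g + c ≡ g i + n * c
  sum-except {suc n} g i c others = begin
    sum g + c                      ≡⟨ cong (_+ c) (sum-remove {i = i} g) ⟩
    g i + sum (g ∘ punchIn i) + c  ≡⟨ cong (λ t → g i + t + c) rest ⟩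
    g i + n * c + c                ≡⟨ +-assoc (g i) (n * c) c ⟩
    g i + (n * c + c)              ≡⟨ cong (g i +_) (+-comm (n * c) c) ⟩
    g i + suc n * c                ∎
    where
    rest : sum (g ∘ punchIn i) ≡ n * c
    rest = trans (sum-cong-≗ (λ j → others (punchIn i j) (punchInᵢ≢i i j))) (sum-const n c)

  χ : Bool → ℕ
  χ true  = 1
  χ false = 0

  χ-∧ : ∀ a b → χ (a ∧ b) ≡ χ a * χ b
  χ-∧ true  b = sym (+-identityʳ (χ b))
  χ-∧ false b = refl

  card-as-sum : ∀ {n} (S : Subset n) → ∣ S ∣ ≡ sum (λ x → χ (lookup S x))
  card-as-sum []          = refl
  card-as-sum (true ∷ S)  = cong suc (card-as-sum S)
  card-as-sum (false ∷ S) = card-as-sum S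

  count : ∀ {n} → (Fin n → Bool) → ℕ
  count p = sum (χ ∘ p)

  count-complement : ∀ {n} (p : Fin n → Bool) → count p + count (not ∘ p) ≡ n
  count-complement {n} p = begin
    count p + count (not ∘ p)            ≡⟨ ∑-distrib-+ (χ ∘ p) (χ ∘ not ∘ p) ⟨
    sum (λ x → χ (p x) + χ (not (p x)))  ≡⟨ sum-cong-≗ (χ-complement ∘ p) ⟩
    sum {n} (λ _ → 1)                    ≡⟨ sum-const n 1 ⟩
    n * 1                                ≡⟨ *-identityʳ n ⟩
    n                                    ∎
    where
    χ-complement : ∀ b → χ b + χ (not b) ≡ 1
    χ-complement true  = refl
    χ-complement false = refl

  sum-by-test : ∀ {n} (p : Fin n → Bool) (g : Fin n → ℕ) a b →
    (∀ x → g x ≡ (if p x then a else b)) → sum g ≡ count p * a + count (not ∘ p) * b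
  sum-by-test p g a b g≡ = begin
    sum g
      ≡⟨ sum-cong-≗ (λ x → trans (g≡ x) (select (p x))) ⟩
    sum (λ x → χ (p x) * a + χ (not (p x)) * b)
      ≡⟨ ∑-distrib-+ (λ x → χ (p x) * a) (λ x → χ (not (p x)) * b) ⟩
    sum (λ x → χ (p x) * a) + sum (λ x → χ (not (p x)) * b)
      ≡⟨ cong₂ _+_ (*-distribʳ-sum a (χ ∘ p)) (*-distribʳ-sum b (χ ∘ not ∘ p)) ⟨
    count p * a + count (not ∘ p) * b ∎
    where
    select : ∀ t → (if t then a else b) ≡ χ t * a + χ (not t) * b
    select true  = sym (trans (+-identityʳ (a + 0)) (+-identityʳ a))
    select false = sym (+-identityʳ b)

module IncidenceCounting {v : ℕ} (B : Blocks v) where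
  open FiniteSums
  open import Data.Nat using (suc; _+_; _*_; _≤_; _<_; _≟_)
  open import Data.Bool using (Bool; not; if_then_else_)
  open import Data.Fin using (Fin)
  open import Data.Fin.Subset using (_∩_; ∣_∣)
  open import Data.Fin.Subset.Properties using (∩-idem)
  open import Data.Vec using (lookup; tabulate)
  open import Data.Vec.Properties using (lookup∘tabulate; lookup-zipWith)
  open import Data.Sum using (_⊎_; inj₁; inj₂)
  open import Function using (_∘_)
  open import Relation.Binary.PropositionalEquality
  open import Relation.Nullary.Decidable using (⌊_⌋; yes; no)
  open import Relation.Nullary.Negation using (contradiction)
  open ≡-Reasoning

  incidence : Fin v → Fin v → ℕ
  incidence j x = χ (lookup (B j) x)

  ρ : Fin v → ℕ
  ρ = replication B

  replication-as-sum : ∀ x → ρ x ≡ sum (λ j → incidence j x)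
  replication-as-sum x = trans (card-as-sum (tabulate (λ j → lookup (B j) x)))
    (sum-cong-≗ (λ j → cong χ (lookup∘tabulate (λ j → lookup (B j) x) j)))

  intersection-as-sum : ∀ i j → ∣ B i ∩ B j ∣ ≡ sum (λ x → incidence i x * incidence j x)
  intersection-as-sum i j = trans (card-as-sum (B i ∩ B j))
    (sum-cong-≗ (λ x → trans (cong χ (lookup-zipWith _ x (B i) (B j)))
                             (χ-∧ (lookup (B i) x) (lookup (B j) x))))

  -- Counting the flags (x, Bⱼ) with x ∈ Bⱼ in two ways.
  replication-sum : sum ρ ≡ sum (λ j → ∣ B j ∣)
  replication-sum = begin
    sum ρ                                      ≡⟨ sum-cong-≗ replication-as-sum ⟩
    sum (λ x → sum (λ j → incidence j x))      ≡⟨ ∑-comm (λ x j → incidence j x) ⟩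
    sum (λ j → sum (incidence j))              ≡⟨ sum-cong-≗ (sym ∘ card-as-sum ∘ B) ⟩
    sum (λ j → ∣ B j ∣)                        ∎

  -- Counting the triples (x, Bᵢ, Bⱼ) with x ∈ Bᵢ ∩ Bⱼ in two ways.
  replication-square-sum : sum (λ x → ρ x * ρ x) ≡ sum (λ i → sum (λ j → ∣ B i ∩ B j ∣))
  replication-square-sum = begin
    sum (λ x → ρ x * ρ x)
      ≡⟨ sum-cong-≗ (λ x → cong₂ _*_ (replication-as-sum x) (replication-as-sum x)) ⟩
    sum (λ x → sum (λ i → incidence i x) * sum (λ j → incidence j x))
      ≡⟨ sum-cong-≗ (λ x → *-distribʳ-sum _ (λ i → incidence i x)) ⟩
    sum (λ x → sum (λ i → incidence i x * sum (λ j → incidence j x)))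
      ≡⟨ sum-cong-≗ (λ x → sum-cong-≗ (λ i → *-distribˡ-sum (incidence i x) (λ j → incidence j x))) ⟩
    sum (λ x → sum (λ i → sum (λ j → incidence i x * incidence j x)))
      ≡⟨ ∑-comm (λ x i → sum (λ j → incidence i x * incidence j x)) ⟩
    sum (λ i → sum (λ x → sum (λ j → incidence i x * incidence j x)))
      ≡⟨ sum-cong-≗ (λ i → ∑-comm (λ x j → incidence i x * incidence j x)) ⟩
    sum (λ i → sum (λ j → sum (λ x → incidence i x * incidence j x)))
      ≡⟨ sum-cong-≗ (λ i → sum-cong-≗ (λ j → intersection-as-sum i j)) ⟨
    sum (λ i → sum (λ j → ∣ B i ∩ B j ∣)) ∎

  intersection-row : ∀ {lam} → (∀ i j → i ≢ j → ∣ B i ∩ B j ∣ ≡ lam) →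
    ∀ i → sum (λ j → ∣ B i ∩ B j ∣) + lam ≡ ∣ B i ∣ + v * lam
  intersection-row {lam} meet i =
    trans (sum-except (λ j → ∣ B i ∩ B j ∣) i lam (λ j j≢i → meet i j (j≢i ∘ sym)))
          (cong (λ S → ∣ S ∣ + v * lam) (∩-idem (B i)))

  moment-identity : ∀ {lam} → (∀ i j → i ≢ j → ∣ B i ∩ B j ∣ ≡ lam) →
    sum (λ x → ρ x * ρ x) + v * lam ≡ sum ρ + v * (v * lam)
  moment-identity {lam} meet = begin
    sum (λ x → ρ x * ρ x) + v * lam
      ≡⟨ cong₂ _+_ replication-square-sum (sym (sum-const v lam)) ⟩
    sum (λ i → sum (λ j → ∣ B i ∩ B j ∣)) + sum {v} (λ _ → lam)
      ≡⟨ ∑-distrib-+ (λ i → sum (λ j → ∣ B i ∩ B j ∣)) (λ _ → lam) ⟨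
    sum (λ i → sum (λ j → ∣ B i ∩ B j ∣) + lam)
      ≡⟨ sum-cong-≗ (intersection-row meet) ⟩
    sum (λ i → ∣ B i ∣ + v * lam)
      ≡⟨ ∑-distrib-+ (λ i → ∣ B i ∣) (λ _ → v * lam) ⟩
    sum (λ i → ∣ B i ∣) + sum {v} (λ _ → v * lam)
      ≡⟨ cong₂ _+_ (sym replication-sum) (sum-const v (v * lam)) ⟩
    sum ρ + v * (v * lam) ∎

  fisher-inequality : ∀ {lam} → (∀ i → lam < ∣ B i ∣) → v * suc lam ≤ sum ρ
  fisher-inequality {lam} big =
    subst₂ _≤_ (sum-const v (suc lam)) (sym replication-sum) (sum-mono big)

  module ReplicationClasses {r₁ r₂ : ℕ} (cover : ∀ x → ρ x ≡ r₁ ⊎ ρ x ≡ r₂) where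
    has-r₁ : Fin v → Bool
    has-r₁ x = ⌊ ρ x ≟ r₁ ⌋

    e₂ : ℕ
    e₂ = count (not ∘ has-r₁)

    e₁-as-count : pointsWithReplication B r₁ ≡ count has-r₁
    e₁-as-count = trans (card-as-sum (tabulate has-r₁)) (sum-cong-≗ (cong χ ∘ lookup∘tabulate has-r₁))

    class-sizes : pointsWithReplication B r₁ + e₂ ≡ v
    class-sizes = trans (cong (_+ e₂) e₁-as-count) (count-complement has-r₁)

    sum-over-classes : (f : ℕ → ℕ) → sum (f ∘ ρ) ≡ pointsWithReplication B r₁ * f r₁ + e₂ * f r₂
    sum-over-classes f = trans (sum-by-test has-r₁ (f ∘ ρ) (f r₁) (f r₂) value)
                               (cong (λ e₁ → e₁ * f r₁ + e₂ * f r₂) (sym e₁-as-count))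
      where
      value : ∀ x → f (ρ x) ≡ (if has-r₁ x then f r₁ else f r₂)
      value x with ρ x ≟ r₁ | cover x
      ... | yes ρx≡r₁ | _          = cong f ρx≡r₁
      ... | no  ρx≢r₁ | inj₁ ρx≡r₁ = contradiction ρx≡r₁ ρx≢r₁
      ... | no  _     | inj₂ ρx≡r₂ = cong f ρx≡r₂

-- Arithmetic consequences of the counting identities.  Throughout, s = r₂ and the
-- replication numbers are normalised as r₁ = 1 + s + c and v = s + c + s.
module ReplicationArithmetic where
  open import Data.Nat
    using (zero; suc; _+_; _*_; _≤_; _<_; z≤n; s≤s; z<s; >-nonZero)
  open import Data.Nat.Properties
  open import Data.Nat.Tactic.RingSolver using (solve-∀)
  open import Data.Product using (∃-syntax; _×_; _,_)
  open import Data.Sum using (inj₁; inj₂)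
  open import Relation.Binary.PropositionalEquality
  open import Relation.Nullary.Negation using (contradiction)

  replication-shape : ∀ {r s v} → s < r → r + s ≡ suc v →
    ∃[ c ] (r ≡ suc (s + c) × v ≡ s + c + s)
  replication-shape s<r r+s≡1+v with m≤n⇒∃[o]m+o≡n s<r
  ... | c , refl = c , refl , suc-injective (sym r+s≡1+v)

  -- The moment identity, split into the two replication classes (of sizes e and e₂)
  -- and divided by v, becomes the key equation e(r₁ − r₂) + r₂² + λ = λv + r₂.
  key-equation : ∀ {s c e e₂ lam S₁ S₂} → let r = suc (s + c) ; v = s + c + s in
    0 < v → e + e₂ ≡ v → S₁ ≡ e * r + e₂ * s → S₂ ≡ e * (r * r) + e₂ * (s * s) →
    S₂ + v * lam ≡ S₁ + v * (v * lam) →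
    e * suc c + s * s + lam ≡ lam * v + s
  key-equation {s} {c} {e} {e₂} {lam} {S₁} {S₂} 0<v classes S₁≡ S₂≡ moment =
    *-cancelˡ-≡ _ _ v {{>-nonZero 0<v}} (+-cancelˡ-≡ (S₁ + S₂) _ _ (begin
      S₁ + S₂ + v * (e * suc c + s * s + lam)        ≡⟨ regroup S₁ S₂ e v c s lam ⟩
      S₁ + e * (v * suc c) + v * (s * s) + (S₂ + v * lam) ≡⟨ cong₂ _+_ (sym split) moment ⟩
      S₂ + v * s + (S₁ + v * (v * lam))                  ≡⟨ collect S₁ S₂ v s lam ⟩
      S₁ + S₂ + v * (lam * v + s)                        ∎))
    where
    open ≡-Reasoning
    r v : ℕ
    r = suc (s + c)
    v = s + c + s
    regroup : ∀ S₁ S₂ e v c s lam →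
      S₁ + S₂ + v * (e * suc c + s * s + lam) ≡ S₁ + e * (v * suc c) + v * (s * s) + (S₂ + v * lam)
    regroup = solve-∀
    collect : ∀ S₁ S₂ v s lam → S₂ + v * s + (S₁ + v * (v * lam)) ≡ S₁ + S₂ + v * (lam * v + s)
    collect = solve-∀
    -- (r² − r) − (s² − s) = (r − s)(r + s − 1) = (1 + c)·v
    squares : ∀ s c e e₂ →
      e * (suc (s + c) * suc (s + c)) + e₂ * (s * s) + (e + e₂) * s
        ≡ e * suc (s + c) + e₂ * s + e * ((s + c + s) * suc c) + (e + e₂) * (s * s)
    squares = solve-∀
    split : S₂ + v * s ≡ S₁ + e * (v * suc c) + v * (s * s)
    split = begin
      S₂ + v * s
        ≡⟨ cong₂ _+_ S₂≡ (cong (_* s) (sym classes)) ⟩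
      e * (r * r) + e₂ * (s * s) + (e + e₂) * s
        ≡⟨ squares s c e e₂ ⟩
      e * r + e₂ * s + e * (v * suc c) + (e + e₂) * (s * s)
        ≡⟨ cong₂ (λ a b → a + e * (v * suc c) + b * (s * s)) (sym S₁≡) classes ⟩
      S₁ + e * (v * suc c) + v * (s * s) ∎

  fisher-consequence : ∀ {s c e e₂ lam S₁} → let r = suc (s + c) ; v = s + c + s in
    e * suc c + s * s + lam ≡ lam * v + s → e + e₂ ≡ v → S₁ ≡ e * r + e₂ * s →
    v * suc lam ≤ S₁ → v + lam ≤ r * s
  fisher-consequence {s} {c} {e} {e₂} {lam} {S₁} key classes S₁≡ fisher =
    +-cancelʳ-≤ (lam * v + s * s) _ _ (begin
      v + lam + (lam * v + s * s)           ≡⟨ expand v s lam ⟩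
      v * suc lam + (s * s + lam)           ≤⟨ +-monoˡ-≤ (s * s + lam) fisher ⟩
      S₁ + (s * s + lam)                    ≡⟨ cong (_+ (s * s + lam)) S₁≡ ⟩
      e * r + e₂ * s + (s * s + lam)        ≡⟨ separate s c e e₂ lam ⟩
      e * suc c + s * s + lam + (e + e₂) * s ≡⟨ cong₂ (λ a b → a + b * s) key classes ⟩
      lam * v + s + v * s                   ≡⟨ factor s c lam ⟩
      r * s + (lam * v + s * s)             ∎)
    where
    open ≤-Reasoning
    r v : ℕ
    r = suc (s + c)
    v = s + c + s
    expand : ∀ v s lam → v + lam + (lam * v + s * s) ≡ v * suc lam + (s * s + lam)
    expand = solve-∀
    separate : ∀ s c e e₂ lam →
      e * suc (s + c) + e₂ * s + (s * s + lam) ≡ e * suc c + s * s + lam + (e + e₂) * s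
    separate = solve-∀
    factor : ∀ s c lam →
      lam * (s + c + s) + s + (s + c + s) * s ≡ suc (s + c) * s + (lam * (s + c + s) + s * s)
    factor = solve-∀

  -- Part (a): if e < r₂ then λ(v − 1) = e(1 + c) + r₂(r₂ − 1) ≤ (r₂ − 1)(r₂ + c + 1),
  -- which is less than (v + 2)(v − 1)/4; hence 4λ ≤ v + 1.
  part-a : ∀ {s c e lam} → e < s →
    e * suc c + s * s + lam ≡ lam * (s + c + s) + s → 4 * lam ≤ suc (s + c + s)
  part-a {suc a} {c} {e} {lam} (s≤s e≤a) key =
    ≤-pred (*-cancelʳ-< m (4 * lam) (3 + m) (begin-strict
      4 * lam * m                          ≡⟨ *-assoc 4 lam m ⟩
      4 * (lam * m)                        ≡⟨ cong (4 *_) lam·m ⟩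
      4 * (e * suc c + a * suc a)          ≤⟨ *-monoʳ-≤ 4 (+-monoˡ-≤ (a * suc a) (*-monoˡ-≤ (suc c) e≤a)) ⟩
      4 * (a * suc c + a * suc a)          <⟨ m<m+n _ z<s ⟩
      4 * (a * suc c + a * suc a) + suc (2 * a + c * c + 5 * c + 3) ≡⟨ margin a c ⟨
      (3 + m) * m                          ∎))
    where
    open ≤-Reasoning
    -- m = v − 1
    m : ℕ
    m = a + c + suc a
    lam·m : lam * m ≡ e * suc c + a * suc a
    lam·m = +-cancelʳ-≡ (lam + suc a) _ _ (begin-equality
      lam * m + (lam + suc a)              ≡⟨ shiftˡ a c lam ⟩
      lam * (suc a + c + suc a) + suc a    ≡⟨ key ⟨
      e * suc c + suc a * suc a + lam      ≡⟨ shiftʳ a c e lam ⟩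
      e * suc c + a * suc a + (lam + suc a) ∎)
      where
      shiftˡ : ∀ a c lam → lam * (a + c + suc a) + (lam + suc a) ≡ lam * (suc a + c + suc a) + suc a
      shiftˡ = solve-∀
      shiftʳ : ∀ a c e lam → e * suc c + suc a * suc a + lam ≡ e * suc c + a * suc a + (lam + suc a)
      shiftʳ = solve-∀
    margin : ∀ a c → (3 + (a + c + suc a)) * (a + c + suc a)
                     ≡ 4 * (a * suc c + a * suc a) + suc (2 * a + c * c + 5 * c + 3)
    margin = solve-∀

  ≤-surplus : ∀ {a b} d → a + d ≡ b → a ≤ b
  ≤-surplus {a} d refl = m≤m+n a d

  -- (x − y + 1)(x − y + 2) ≥ 0, a product of two consecutive integers, stated in ℕ.
  consecutive-product : ∀ x y → 2 * x * y + 3 * y ≤ x * x + y * y + 3 * x + 2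
  consecutive-product x y with ≤-<-connex y x
  ... | inj₁ y≤x with m≤n⇒∃[o]m+o≡n y≤x
  ...   | u , refl = ≤-surplus (u * u + 3 * u + 2) (above y u)
    where
    above : ∀ y u → 2 * (y + u) * y + 3 * y + (u * u + 3 * u + 2)
                    ≡ (y + u) * (y + u) + y * y + 3 * (y + u) + 2
    above = solve-∀
  consecutive-product x y | inj₂ x<y with m≤n⇒∃[o]m+o≡n x<y
  ... | zero  , refl = ≤-reflexive (adjacent x)
    where
    adjacent : ∀ x → 2 * x * (suc x + 0) + 3 * (suc x + 0) ≡ x * x + (suc x + 0) * (suc x + 0) + 3 * x + 2
    adjacent = solve-∀
  ... | suc w , refl = ≤-surplus (w * suc w) (below x w)
    where
    below : ∀ x w → 2 * x * (suc x + suc w) + 3 * (suc x + suc w) + w * suc w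
                    ≡ x * x + (suc x + suc w) * (suc x + suc w) + 3 * x + 2
    below = solve-∀

  -- In case (b) the smaller replication number is at least 2: r₂ = 0 contradicts
  -- v + λ ≤ r₁r₂ since v > 0, and r₂ = 1 forces λ = 0 and then e = 0 < r₂.
  two≤r₂ : ∀ {s c e lam} → let v = s + c + s in
    s ≤ e → 0 < v → v + lam ≤ suc (s + c) * s →
    e * suc c + s * s + lam ≡ lam * v + s → 2 ≤ s
  two≤r₂ {zero} {c} _ 0<v fisher _ = contradiction v≤0 (<⇒≱ 0<v)
    where
    v≤0 : c + 0 ≤ 0
    v≤0 = m+n≤o⇒m≤o (c + 0) (≤-trans fisher (≤-reflexive (*-zeroʳ (suc c))))
  two≤r₂ {suc zero} {c} {e} {lam} 1≤e _ fisher key with n≤0⇒n≡0 lam≤0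
    where
    -- here v = r₁ = 2 + c, so v + λ ≤ r₁ leaves no room for λ
    lam≤0 : lam ≤ 0
    lam≤0 = +-cancelˡ-≤ (suc (c + 1)) lam 0 (≤-trans fisher (≤-reflexive (r₁≡v c)))
      where
      r₁≡v : ∀ c → suc (suc c) * 1 ≡ suc (c + 1) + 0
      r₁≡v = solve-∀
  ... | refl with m*n≡0⇒m≡0∨n≡0 e (+-cancelʳ-≡ 1 (e * suc c) 0 (trans (unit e c) key))
    where
    unit : ∀ e c → e * suc c + 1 ≡ e * suc c + 1 * 1 + 0
    unit = solve-∀
  ...   | inj₁ refl = contradiction 1≤e λ ()
  ...   | inj₂ ()
  two≤r₂ {suc (suc p)} _ _ _ _ = s≤s (s≤s z≤n)

  -- For r₂ ≥ 2 and e ≥ r₂ the key equation forces e > λ: if e ≤ λ, writing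
  -- λ = r₂ + u, the equation would give λ(2r₂ − 2) + r₂ ≤ r₂², which fails.
  lam<e : ∀ {s c e lam} → 2 ≤ s → s ≤ e →
    e * suc c + s * s + lam ≡ lam * (s + c + s) + s → lam < e
  lam<e {s} {c} {e} {lam} (s≤s (s≤s {n = p} _)) s≤e key with ≤-<-connex e lam
  ... | inj₂ lam<e = lam<e
  ... | inj₁ e≤lam with m≤n⇒∃[o]m+o≡n (≤-trans s≤e e≤lam)
  ...   | u , refl = contradiction (begin
          lam * suc c + s * s + lam + suc (p + suc p * suc p + 2 * u * suc p) ≡⟨ surplus p u c ⟩
          lam * (s + c + s) + s                                              ≡⟨ key ⟨
          e * suc c + s * s + lam    ≤⟨ +-monoˡ-≤ lam (+-monoˡ-≤ (s * s) (*-monoˡ-≤ (suc c) e≤lam)) ⟩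
          lam * suc c + s * s + lam  ∎) (m+1+n≰m _)
    where
    open ≤-Reasoning
    surplus : ∀ p u c →
      (2 + p + u) * suc c + (2 + p) * (2 + p) + (2 + p + u) + suc (p + suc p * suc p + 2 * u * suc p)
        ≡ (2 + p + u) * ((2 + p) + c + (2 + p)) + (2 + p)
    surplus = solve-∀

  -- Part (b): if e ≥ r₂ then, writing e = λ + 1 + d, the key equation gives
  -- (1 + c) + λ(1 + c) + r₂² + λ ≤ λv + r₂; adding (λ − r₂ + 1)(λ − r₂ + 2) ≥ 0
  -- yields v ≤ λ² + λ + 1.
  part-b : ∀ {s c e lam} → let v = s + c + s in
    s ≤ e → 0 < v → v + lam ≤ suc (s + c) * s →
    e * suc c + s * s + lam ≡ lam * v + s → v ≤ lam * lam + lam + 1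
  part-b {s} {c} {e} {lam} s≤e 0<v fisher key
    with m≤n⇒∃[o]m+o≡n (lam<e (two≤r₂ s≤e 0<v fisher key) s≤e key)
  ... | d , refl = ≤-pred (+-cancelˡ-≤ X _ _ (begin
      X + suc v
        ≡⟨ gather s c lam ⟩
      (suc lam * suc c + s * s + lam) + (2 * lam * s + 3 * s)
        ≤⟨ +-mono-≤ (+-monoˡ-≤ lam (+-monoˡ-≤ (s * s) (*-monoˡ-≤ (suc c) (m≤m+n (suc lam) d))))
                    (consecutive-product lam s) ⟩
      ((suc lam + d) * suc c + s * s + lam) + (lam * lam + s * s + 3 * lam + 2)
        ≡⟨ cong (_+ (lam * lam + s * s + 3 * lam + 2)) key ⟩
      (lam * v + s) + (lam * lam + s * s + 3 * lam + 2)
        ≡⟨ scatter s c lam ⟩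
      X + suc (lam * lam + lam + 1) ∎))
    where
    open ≤-Reasoning
    v X : ℕ
    v = s + c + s
    X = lam * c + 2 * lam + 2 * lam * s + s * s + s
    gather : ∀ s c lam → lam * c + 2 * lam + 2 * lam * s + s * s + s + suc (s + c + s)
                         ≡ (suc lam * suc c + s * s + lam) + (2 * lam * s + 3 * s)
    gather = solve-∀
    scatter : ∀ s c lam → (lam * (s + c + s) + s) + (lam * lam + s * s + 3 * lam + 2)
                          ≡ lam * c + 2 * lam + 2 * lam * s + s * s + s + suc (lam * lam + lam + 1)
    scatter = solve-∀

  replication-bounds : ∀ {v lam r s e e₂ S₁ S₂} → s < r → r + s ≡ suc v → 0 < v →
    e + e₂ ≡ v → S₁ ≡ e * r + e₂ * s → S₂ ≡ e * (r * r) + e₂ * (s * s) →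
    S₂ + v * lam ≡ S₁ + v * (v * lam) → v * suc lam ≤ S₁ →
    (e < s → 4 * lam ≤ suc v) × (s ≤ e → v ≤ lam * lam + lam + 1)
  replication-bounds {lam = lam} {s = s} {e = e} {e₂ = e₂} s<r r+s≡1+v 0<v classes S₁≡ S₂≡ moment fisher
    with replication-shape s<r r+s≡1+v
  ... | c , refl , refl =
    (λ e<s → part-a e<s key) ,
    (λ s≤e → part-b s≤e 0<v (fisher-consequence {s} {c} {e} {e₂} key classes S₁≡ fisher) key)
    where
    key : e * suc c + s * s + lam ≡ lam * (s + c + s) + s
    key = key-equation {s} {c} {e} {e₂} 0<v classes S₁≡ S₂≡ moment

open import Data.Integer using (+_; _-_; _≤_; _≥_; -1ℤ; _*_; _+_; +≤+; _⊖_)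
open import Data.Product using (_×_; _,_; proj₁; proj₂)
import Data.Nat as ℕ
import Data.Nat.Properties as ℕ
import Data.Integer.Properties as ℤ
open import Data.Fin.Properties using (nonZeroIndex)
open import Function using (id)
open import Relation.Binary.PropositionalEquality using (cong)
open import Relation.Nullary.Negation using (contradiction)
open IncidenceCounting using (moment-identity; fisher-inequality; module ReplicationClasses)
open ReplicationArithmetic using (replication-bounds)

negative-difference : ∀ m n → + m - + n ≤ -1ℤ → m ℕ.< n
negative-difference m n D≤-1 =
  ℕ.≰⇒> (λ n≤m → contradiction (ℤ.≤-trans (ℤ.i≤j⇒0≤j-i (+≤+ n≤m)) D≤-1) λ ())

nonnegative-difference : ∀ m n → + 0 ≤ + m - + n → n ℕ.≤ m
nonnegative-difference m n 0≤D = ℤ.drop‿+≤+ (ℤ.0≤i-j⇒j≤i 0≤D)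

bound-a-in-ℤ : ∀ v lam → 4 ℕ.* lam ℕ.≤ ℕ.suc v → + v ≥ + 4 * + lam - + 1
bound-a-in-ℤ v lam 4lam≤1+v = begin
  + 4 * + lam - + 1    ≡⟨ cong (_- + 1) (ℤ.pos-* 4 lam) ⟨
  + (4 ℕ.* lam) - + 1  ≡⟨ ℤ.[+m]-[+n]≡m⊖n (4 ℕ.* lam) 1 ⟩
  4 ℕ.* lam ⊖ 1        ≤⟨ ℤ.⊖-monoˡ-≤ 1 4lam≤1+v ⟩
  ℕ.suc v ⊖ 1          ≡⟨ ℤ.[1+m]⊖[1+n]≡m⊖n v 0 ⟩
  + v                  ∎
  where open ℤ.≤-Reasoning

bound-b-in-ℤ : ∀ v lam → v ℕ.≤ lam ℕ.* lam ℕ.+ lam ℕ.+ 1 → + lam * + lam + + lam + + 1 ≥ + v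
bound-b-in-ℤ v lam v≤ = begin
  + v                                   ≤⟨ +≤+ v≤ ⟩
  + (lam ℕ.* lam ℕ.+ lam ℕ.+ 1)         ≡⟨ ℤ.pos-+ (lam ℕ.* lam ℕ.+ lam) 1 ⟩
  + (lam ℕ.* lam ℕ.+ lam) + + 1         ≡⟨ cong (_+ + 1) (ℤ.pos-+ (lam ℕ.* lam) lam) ⟩
  + (lam ℕ.* lam) + + lam + + 1         ≡⟨ cong (λ t → t + + lam + + 1) (ℤ.pos-* lam lam) ⟩
  + lam * + lam + + lam + + 1           ∎
  where open ℤ.≤-Reasoning

theorem1p12 : (v lam : ℕ) (B : Blocks v) → IsRyserDesign v lam B →
    (r₁ r₂ : ℕ) → AreReplicationNumbers v B r₁ r₂ →
    let D = + pointsWithReplication B r₁ - + r₂ in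
    (D ≤ -1ℤ → + v ≥ + 4 * + lam - + 1) ×
    (+ 0 ≤ D → + lam * + lam + + lam + + 1 ≥ + v)
theorem1p12 v lam B design r₁ r₂ rn =
  (λ D≤-1 → bound-a-in-ℤ v lam (proj₁ bounds (negative-difference _ _ D≤-1))) ,
  (λ 0≤D → bound-b-in-ℤ v lam (proj₂ bounds (nonnegative-difference _ _ 0≤D)))
  where
  open IsRyserDesign design
  open AreReplicationNumbers rn
  open ReplicationClasses B cover
  e₁ : ℕ
  e₁ = pointsWithReplication B r₁
  bounds : (e₁ ℕ.< r₂ → 4 ℕ.* lam ℕ.≤ ℕ.suc v) × (r₂ ℕ.≤ e₁ → v ℕ.≤ lam ℕ.* lam ℕ.+ lam ℕ.+ 1)
  bounds = replication-bounds r₂<r₁ sumRule (ℕ.>-nonZero⁻¹ v {{nonZeroIndex (proj₁ twoSizes)}})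
    class-sizes (sum-over-classes id) (sum-over-classes (λ t → t ℕ.* t))
    (moment-identity B intersect) (fisher-inequality B bigBlocks)
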